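{- Let $n\ge 3$ and let $x,y$ be two distinct pyramidal tours in $K_n$. The vertices $x^{v}$ and $y^{v}$ of the polytope $\mathrm{PYR}(n)$ are not adjacent if and only if there exists a pyramidal tour $z$ in $K_n$, different from $x$ and from $y$, every edge of which is an edge of $x$ or an edge of $y$.
   Context: Let $K_n$ be the complete undirected graph on vertex set $\{1,\dots,n\}$ with edge set $E$. A Hamiltonian tour $\langle 1,i_1,\dots,i_r,n,j_1,\dots,j_{n-r-2}\rangle$ is called pyramidal if $i_1<i_2<\dots<i_r$ and $j_1>j_2>\dots>j_{n-r-2}$ (tours are undirected). For a tour $x$, its characteristic vector $x^{v}\in\mathbb{R}^{E}$ has $x^{v}_e=1$ if $e$ is an edge of $x$ and $0$ otherwise. The pyramidal tours polytope is $\mathrm{PYR}(n)=\mathrm{conv}\{x^{v} : x \text{ a pyramidal tour in } K_n\}$. Two vertices of a polytope are adjacent if the segment joining them is a one-dimensional face (edge) of the polytope.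
   Formalization: Adjacency of $x^{v}$ and $y^{v}$ is expressed by a linear functional exposing their segment as a face, with coefficients taken in ℚ rather than ℝ. -}

module Defs where

open import Data.Nat as ℕ using (ℕ; zero; suc; _∸_; _≤_; _<_)
import Data.Nat.Properties as ℕP
open import Data.Fin using (Fin; toℕ)
import Data.Fin.Properties as FinP
open import Data.Rational as ℚ using (ℚ)
open import Data.Product using (Σ; ∃; _×_; _,_)
open import Data.Sum using (_⊎_)
open import Relation.Binary.PropositionalEquality using (_≡_)
open import Relation.Nullary using (¬_; Dec; does)
open import Relation.Nullary.Decidable using (_×-dec_; _⊎-dec_)
open import Function.Definitions using (Injective)
open import Data.Bool using (if_then_else_)
open import Data.Integer using (+_)

-- Vertices 1,…,n of K_n are represented by Fin n (label k ↦ k-1).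
-- A tour is listed as a sequence of vertices t 0, t 1, …, t (n-1),
-- closing back to t 0.  It must visit every vertex exactly once.
Tour : ℕ → Set
Tour n = Fin n → Fin n

IsHamiltonian : ∀ {n} → Tour n → Set
IsHamiltonian t = Injective _≡_ _≡_ t

Pyramidal : ∀ {n} → Tour n → Set
Pyramidal {n} t =
  IsHamiltonian t ×
  (∀ i → toℕ i ≡ 0 → toℕ (t i) ≡ 0) ×
  ∃ λ (k : Fin n) →
    toℕ (t k) ≡ n ∸ 1 ×
    (∀ i j → toℕ i < toℕ j → toℕ j ≤ toℕ k → toℕ (t i) < toℕ (t j)) ×
    (∀ i j → toℕ k ≤ toℕ i → toℕ i < toℕ j → toℕ (t j) < toℕ (t i))

CycSucc : ∀ {n} → Fin n → Fin n → Set
CycSucc {n} i j = (suc (toℕ i) ≡ toℕ j) ⊎ (suc (toℕ i) ≡ n × toℕ j ≡ 0)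

TourEdge : ∀ {n} → Tour n → Fin n → Fin n → Set
TourEdge t a b = ∃ λ i → ∃ λ j → CycSucc i j ×
  ((t i ≡ a × t j ≡ b) ⊎ (t i ≡ b × t j ≡ a))

tourEdge? : ∀ {n} (t : Tour n) a b → Dec (TourEdge t a b)
tourEdge? {n} t a b = FinP.any? λ i → FinP.any? λ j →
  ((suc (toℕ i) ℕP.≟ toℕ j) ⊎-dec ((suc (toℕ i) ℕP.≟ n) ×-dec (toℕ j ℕP.≟ 0)))
  ×-dec (((t i FinP.≟ a) ×-dec (t j FinP.≟ b)) ⊎-dec ((t i FinP.≟ b) ×-dec (t j FinP.≟ a)))

χ : ∀ {n} → Tour n → Fin n → Fin n → ℕ
χ t a b = if does (tourEdge? t a b) then 1 else 0

-- two tours are the same (undirected) tour iff they have the same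
-- characteristic vector
SameTour : ∀ {n} → Tour n → Tour n → Set
SameTour x y = ∀ a b → χ x a b ≡ χ y a b

sumFin : ∀ {n} → (Fin n → ℚ) → ℚ
sumFin {zero}  f = ℚ.0ℚ
sumFin {suc n} f = f Fin.zero ℚ.+ sumFin (λ i → f (Fin.suc i))
  where import Data.Fin as Fin

_·χ_ : ∀ {n} → (Fin n → Fin n → ℚ) → Tour n → ℚ
c ·χ t = sumFin λ a → sumFin λ b →
  if does (toℕ a ℕ.<? toℕ b) then c a b ℚ.* ((+ χ t a b) ℚ./ 1) else ℚ.0ℚ

-- x^v and y^v are adjacent vertices of PYR(n): the segment [x^v,y^v]
-- is a face, i.e. some linear functional attains its maximum over
-- PYR(n) exactly at x^v and y^v among the vertices.
Adjacent : ∀ {n} → Tour n → Tour n → Set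
Adjacent {n} x y = ∃ λ (c : Fin n → Fin n → ℚ) →
  (c ·χ x ≡ c ·χ y) ×
  (∀ (z : Tour n) → Pyramidal z → ¬ SameTour z x → ¬ SameTour z y →
     c ·χ z ℚ.< c ·χ x)

-- A pyramidal tour on the vertices 0, …, N (N = n-1) is determined by which inner
-- vertices 1, …, N-1 lie on its ascending path, i.e. by a labelling of them; {a,b}
-- with a < b is an edge iff a and b lie on a common path (0 and N lie on both) and
-- no vertex strictly between them does.
--
-- Let z ≠ x, y be pyramidal with all its edges in x or y, let X, Y, Z be the
-- labellings of x, y, z, and let z′ be the pyramidal tour labelled by X ⊕ Y ⊕ Z.
-- Fix a < b. If X ⊕ Z is constant on the inner vertices of [a,b], then {a,b} is an
-- edge of x iff of z, and of y iff of z′; symmetrically if Y ⊕ Z is constant. If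
-- neither is, none of the four tours has the edge {a,b}: sweeping from a towards
-- b, every switch of X ⊕ Z or Y ⊕ Z lies under an edge of z, which is an edge of
-- x or of y and therefore keeps X ⊕ Z or Y ⊕ Z constant across it. Hence
-- χ x + χ y = χ z + χ z′ and z′ ≠ x, y, so a linear functional maximised over
-- PYR(n) exactly at x and y cannot exist.
--
-- Conversely, if there is no such z, the functional that is 0 on the edges of x
-- and y and -1 elsewhere is maximised exactly at x and y. As there are finitely
-- many tours, the existence of z is decidable, so this contrapositive suffices.
{-# OPTIONS --safe #-}
module Submission where

open import Defs
open import Data.Nat as ℕ using (ℕ; zero; suc; _+_; _∸_; _≤_; _<_; z≤n; s≤s; s≤s⁻¹; _≟_; _<?_; _≤?_)
open import Data.Nat.Properties
open import Data.Fin as Fin using (Fin; toℕ; fromℕ; fromℕ<; punchOut)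
import Data.Fin.Properties as Finₚ
open import Data.Vec.Functional using (_∷_)
open import Data.Bool using (Bool; true; false; not; _xor_; _∨_; if_then_else_)
open import Data.Bool.Properties
  using (xor-assoc; xor-comm; xor-same; xor-identityʳ; xor-annihilates-not; ¬-not; not-¬; ∨-zeroʳ)
  renaming (_≟_ to _≟ᵇ_)
open import Data.Integer using (+_)
open import Data.Rational as ℚ using (ℚ; 0ℚ; 1ℚ)
import Data.Rational.Properties as ℚₚ
open import Algebra.Properties.CommutativeMonoid.Sum ℚₚ.+-0-commutativeMonoid
  using (sum; ∑-distrib-+; sum-cong-≗)
open import Data.Product as Product using (Σ; ∃; ∃₂; _×_; _,_; proj₁; proj₂)
open import Data.Sum as Sum using (_⊎_; inj₁; inj₂; [_,_]′; swap)
open import Data.Empty using (⊥-elim)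
open import Relation.Nullary using (¬_; Dec; yes; no; does; contradiction)
open import Relation.Nullary.Decidable
  using (_×-dec_; _⊎-dec_; _→-dec_; ¬?; map′; toWitness; dec-true; dec-false; decidable-stable)
open import Relation.Binary.PropositionalEquality
open import Relation.Binary.Definitions using (Tri; tri<; tri≈; tri>)
open import Function using (_∘_)
open import Function.Definitions using (Injective)
open import Function.Bundles using (_⇔_; mk⇔; Equivalence)
open import Function.Properties.Equivalence using () renaming (trans to ⇔-trans; sym to ⇔-sym)

xor-cancelˡ : ∀ x y → x xor (x xor y) ≡ y
xor-cancelˡ x y = trans (sym (xor-assoc x x y)) (cong (_xor y) (xor-same x))

xor-cancelʳ : ∀ x y → (x xor y) xor y ≡ x
xor-cancelʳ x y = trans (xor-assoc x y y) (trans (cong (x xor_) (xor-same y)) (xor-identityʳ x))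

xor-leftComm : ∀ x y z → x xor (y xor z) ≡ y xor (x xor z)
xor-leftComm x y z = trans (sym (xor-assoc x y z)) (trans (cong (_xor z) (xor-comm x y)) (xor-assoc y x z))

¬⇒¬⇒⇔ : ∀ {P Q : Set} → ¬ P → ¬ Q → P ⇔ Q
¬⇒¬⇒⇔ ¬p ¬q = mk⇔ (⊥-elim ∘ ¬p) (⊥-elim ∘ ¬q)

≤⇒≡⊎≡⊎< : ∀ {a b v} → a ≤ v → v ≤ b → v ≡ a ⊎ v ≡ b ⊎ (a < v × v < b)
≤⇒≡⊎≡⊎< a≤v v≤b with m≤n⇒m<n∨m≡n a≤v | m≤n⇒m<n∨m≡n v≤b
... | inj₂ a≡v | _         = inj₁ (sym a≡v)
... | inj₁ _   | inj₂ v≡b  = inj₂ (inj₁ v≡b)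
... | inj₁ a<v | inj₁ v<b  = inj₂ (inj₂ (a<v , v<b))

true⊎false : ∀ b → b ≡ true ⊎ b ≡ false
true⊎false true  = inj₁ refl
true⊎false false = inj₂ refl

does≡true⇒ : ∀ {P : Set} (d : Dec P) → does d ≡ true → P
does≡true⇒ (yes p) _ = p

does≡false⇒¬ : ∀ {P : Set} (d : Dec P) → does d ≡ false → ¬ P
does≡false⇒¬ (no ¬p) _ = ¬p

-- Labellings

_⊕_ : (ℕ → Bool) → (ℕ → Bool) → ℕ → Bool
(F ⊕ G) v = F v xor G v

module Labellings (N : ℕ) where

  -- A labelling L, of which only the values at the inner vertices 1, …, N-1
  -- matter, stands for the pyramidal tour whose ascending path visits 0, N and
  -- L⁻¹(true) and whose descending path visits 0, N and L⁻¹(false); for a < b,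
  -- Edge L a b says that {a,b} is an edge of this tour.
  OnPath : (ℕ → Bool) → Bool → ℕ → Set
  OnPath L s v = v ≡ 0 ⊎ v ≡ N ⊎ L v ≡ s

  Gap : (ℕ → Bool) → Bool → ℕ → ℕ → Set
  Gap L s a b = ∀ w → a < w → w < b → L w ≢ s

  Edge : (ℕ → Bool) → ℕ → ℕ → Set
  Edge L a b = Σ Bool λ s → OnPath L s a × OnPath L s b × Gap L s a b

  Inner : ℕ → ℕ → ℕ → Set
  Inner a b v = a ≤ v × v ≤ b × 0 < v × v < N

  Constant : (ℕ → Bool) → ℕ → ℕ → Set
  Constant F a b = ∀ {v w} → Inner a b v → Inner a b w → F v ≡ F w

  SwitchAt : (ℕ → Bool) → ℕ → Set
  SwitchAt F q = 0 < q × suc q < N × F q ≢ F (suc q)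

  LastSwitch : (ℕ → Bool) → ℕ → ℕ → Set
  LastSwitch F a r = ∃ λ q → a ≤ q × q < r × SwitchAt F q × Constant F (suc q) r

  private variable
    A B F G L Z : ℕ → Bool
    a b p q r : ℕ
    s : Bool

  boundary⊎inner : ∀ {v} → v ≤ N → v ≡ 0 ⊎ v ≡ N ⊎ (0 < v × v < N)
  boundary⊎inner {zero} _ = inj₁ refl
  boundary⊎inner {suc v} v≤N with m≤n⇒m<n∨m≡n v≤N
  ... | inj₁ v<N = inj₂ (inj₂ (s≤s z≤n , v<N))
  ... | inj₂ v≡N = inj₂ (inj₁ v≡N)

  inner-exists : 2 ≤ N → a < b → b ≤ N → ∃ (Inner a b)
  inner-exists {zero}  2≤N a<b b≤N = 1 , z≤n , a<b , s≤s z≤n , 2≤N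
  inner-exists {suc a} 2≤N a<b b≤N = suc a , ≤-refl , <⇒≤ a<b , s≤s z≤n , <-≤-trans a<b b≤N

  onPath-inner : ∀ {v} → OnPath L s v → 0 < v → v < N → L v ≡ s
  onPath-inner (inj₁ refl)        0<v _   = contradiction 0<v (<-irrefl refl)
  onPath-inner (inj₂ (inj₁ refl)) _   v<N = contradiction v<N (<-irrefl refl)
  onPath-inner (inj₂ (inj₂ Lv≡s)) _   _   = Lv≡s

  onPath? : ∀ L s v → Dec (OnPath L s v)
  onPath? L s v with v ≟ 0 | v ≟ N | L v ≟ᵇ s
  ... | yes v≡0 | _       | _       = yes (inj₁ v≡0)
  ... | no _    | yes v≡N | _       = yes (inj₂ (inj₁ v≡N))
  ... | no _    | no _    | yes Lv≡s = yes (inj₂ (inj₂ Lv≡s))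
  ... | no v≢0  | no v≢N  | no Lv≢s = no [ v≢0 , [ v≢N , Lv≢s ]′ ]′

  constant-cong : (∀ v → F v ≡ G v) → Constant F a b → Constant G a b
  constant-cong {F} {G} F≗G c {v} {w} iv iw = trans (sym (F≗G v)) (trans (c iv iw) (F≗G w))

  constant-⊕ : Constant F a b → Constant G a b → Constant (F ⊕ G) a b
  constant-⊕ cF cG iv iw = cong₂ _xor_ (cF iv iw) (cG iv iw)

  constant-⊕-comm : Constant (F ⊕ G) a b → Constant (G ⊕ F) a b
  constant-⊕-comm {F} {G} = constant-cong (λ v → xor-comm (F v) (G v))

  constant-mono : a ≤ p → q ≤ b → Constant F a b → Constant F p q
  constant-mono a≤p q≤b c (p≤v , v≤q , v-inner) (p≤w , w≤q , w-inner) =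
    c (≤-trans a≤p p≤v , ≤-trans v≤q q≤b , v-inner) (≤-trans a≤p p≤w , ≤-trans w≤q q≤b , w-inner)

  constant-zero : Constant F a 0
  constant-zero (_ , v≤0 , 0<v , _) = contradiction (<-≤-trans 0<v v≤0) (<-irrefl refl)

  constant-empty : b < a → Constant F a b
  constant-empty b<a (a≤v , v≤b , _) = contradiction (<-≤-trans b<a a≤v) (≤⇒≯ v≤b)

  constant-point : Constant F a a
  constant-point {F} (a≤v , v≤a , _) (a≤w , w≤a , _) =
    cong F (trans (≤-antisym v≤a a≤v) (≤-antisym a≤w w≤a))

  constant⇒step : 0 < r → suc r < N → a ≤ r → suc r ≤ b → Constant F a b → F r ≡ F (suc r)
  constant⇒step 0<r sr<N a≤r sr≤b c =
    c (a≤r , <⇒≤ sr≤b , 0<r , <-trans (n<1+n _) sr<N) (m≤n⇒m≤1+n a≤r , sr≤b , s≤s z≤n , sr<N)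

  switch⇒¬constant : SwitchAt F r → a ≤ r → suc r ≤ b → ¬ Constant F a b
  switch⇒¬constant (0<r , sr<N , Fr≢Fsr) a≤r sr≤b c = Fr≢Fsr (constant⇒step 0<r sr<N a≤r sr≤b c)

  lastSwitch⇒¬constant : LastSwitch F a b → ¬ Constant F a b
  lastSwitch⇒¬constant (q , a≤q , q<b , sw , _) = switch⇒¬constant sw a≤q q<b

  Step : (ℕ → Bool) → ℕ → ℕ → Set
  Step F a r = Inner a (suc r) r → Inner a (suc r) (suc r) → F r ≡ F (suc r)

  step⊎switch : ∀ F a r → Step F a r ⊎ (a ≤ r × SwitchAt F r)
  step⊎switch F a r with a ≤? r | 0 <? r | suc r <? N | F r ≟ᵇ F (suc r)
  ... | yes a≤r | yes 0<r | yes sr<N | no Fr≢Fsr = inj₂ (a≤r , 0<r , sr<N , Fr≢Fsr)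
  ... | no a≰r  | _       | _        | _         = inj₁ λ (a≤r , _) _ → contradiction a≤r a≰r
  ... | yes _   | no 0≮r  | _        | _         = inj₁ λ (_ , _ , 0<r , _) _ → contradiction 0<r 0≮r
  ... | yes _   | yes _   | no sr≮N  | _         = inj₁ λ _ (_ , _ , _ , sr<N) → contradiction sr<N sr≮N
  ... | yes _   | yes _   | yes _    | yes Fr≡Fsr = inj₁ λ _ _ → Fr≡Fsr

  inner-suc : ∀ {v} → Inner a (suc r) v → Inner a r v ⊎ v ≡ suc r
  inner-suc (a≤v , v≤sr , v-inner) with m≤n⇒m<n∨m≡n v≤sr
  ... | inj₁ v<sr = inj₁ (a≤v , s≤s⁻¹ v<sr , v-inner)
  ... | inj₂ v≡sr = inj₂ v≡sr

  inner-top : ∀ {v} → Inner a r v → Inner a (suc r) (suc r) → Inner a r r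
  inner-top (a≤v , v≤r , 0<v , _) (_ , _ , _ , sr<N) =
    ≤-trans a≤v v≤r , ≤-refl , <-≤-trans 0<v v≤r , <-trans (n<1+n _) sr<N

  inner-widen : ∀ {v} → Inner a r v → Inner a (suc r) v
  inner-widen (a≤v , v≤r , inner) = a≤v , m≤n⇒m≤1+n v≤r , inner

  constant-extend : Constant F a r → Step F a r → Constant F a (suc r)
  constant-extend c step iv iw with inner-suc iv | inner-suc iw
  ... | inj₁ iv′  | inj₁ iw′  = c iv′ iw′
  ... | inj₂ refl | inj₂ refl = refl
  ... | inj₁ iv′  | inj₂ refl =
    trans (c iv′ (inner-top iv′ iw)) (step (inner-widen (inner-top iv′ iw)) iw)
  ... | inj₂ refl | inj₁ iw′  =
    sym (trans (c iw′ (inner-top iw′ iv)) (step (inner-widen (inner-top iw′ iv)) iv))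

  constant⊎lastSwitch : ∀ F a r → Constant F a r ⊎ LastSwitch F a r
  constant⊎lastSwitch F a zero = inj₁ constant-zero
  constant⊎lastSwitch F a (suc r) with constant⊎lastSwitch F a r
  ... | inj₁ c with step⊎switch F a r
  ...   | inj₁ step       = inj₁ (constant-extend c step)
  ...   | inj₂ (a≤r , sw) = inj₂ (r , a≤r , n<1+n r , sw , constant-point)
  constant⊎lastSwitch F a (suc r) | inj₂ (q , a≤q , q<r , sw , c) with step⊎switch F (suc q) r
  ... | inj₁ step        = inj₂ (q , a≤q , m<n⇒m<1+n q<r , sw , constant-extend c step)
  ... | inj₂ (_ , sw′)   = inj₂ (r , ≤-trans a≤q (<⇒≤ q<r) , n<1+n r , sw′ , constant-point)

  edge-between : (e : Edge L a b) → a < p → p < b → L p ≡ not (proj₁ e)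
  edge-between (_ , _ , _ , gap) a<p p<b = ¬-not (gap _ a<p p<b)

  edge⇒constant-between : Edge L a b → a < p → q < b → Constant L p q
  edge⇒constant-between e a<p q<b (p≤v , v≤q , _) (p≤w , w≤q , _) =
    trans (edge-between e (<-≤-trans a<p p≤v) (≤-<-trans v≤q q<b))
          (sym (edge-between e (<-≤-trans a<p p≤w) (≤-<-trans w≤q q<b)))

  edge-⊕-value : (eA : Edge A a b) (eB : Edge B a b) → ∀ {v} → Inner a b v →
                 (A ⊕ B) v ≡ proj₁ eA xor proj₁ eB
  edge-⊕-value {A} {a} {b} {B} eA eB (a≤v , v≤b , 0<v , v<N) with ≤⇒≡⊎≡⊎< a≤v v≤b
  ... | inj₁ refl = cong₂ _xor_ (onPath-inner {A} (proj₁ (proj₂ eA)) 0<v v<N)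
                                (onPath-inner {B} (proj₁ (proj₂ eB)) 0<v v<N)
  ... | inj₂ (inj₁ refl) = cong₂ _xor_ (onPath-inner {A} (proj₁ (proj₂ (proj₂ eA))) 0<v v<N)
                                       (onPath-inner {B} (proj₁ (proj₂ (proj₂ eB))) 0<v v<N)
  edge-⊕-value eA eB _ | inj₂ (inj₂ (a<v , v<b)) =
    trans (cong₂ _xor_ (edge-between eA a<v v<b) (edge-between eB a<v v<b))
          (xor-annihilates-not (proj₁ eA) (proj₁ eB))

  edges⇒constant : Edge A a b → Edge B a b → Constant (A ⊕ B) a b
  edges⇒constant eA eB iv iw = trans (edge-⊕-value eA eB iv) (sym (edge-⊕-value eA eB iw))

  constant⇒edge : 2 ≤ N → a < b → b ≤ N → Constant (A ⊕ B) a b → Edge A a b → Edge B a b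
  constant⇒edge {a} {b} {A} {B} 2≤N a<b b≤N c (s , onA , onB , gap) =
    s xor d , transfer ≤-refl (<⇒≤ a<b) onA , transfer (<⇒≤ a<b) ≤-refl onB , gap′
    where
    v₀ = proj₁ (inner-exists 2≤N a<b b≤N)
    d = (A ⊕ B) v₀
    B≡A⊕d : ∀ {u} → Inner a b u → B u ≡ A u xor d
    B≡A⊕d {u} iu = trans (sym (xor-cancelˡ (A u) (B u)))
                         (cong (A u xor_) (c iu (proj₂ (inner-exists 2≤N a<b b≤N))))
    transfer : ∀ {u} → a ≤ u → u ≤ b → OnPath A s u → OnPath B (s xor d) u
    transfer a≤u u≤b onA with boundary⊎inner (≤-trans u≤b b≤N)
    ... | inj₁ u≡0 = inj₁ u≡0
    ... | inj₂ (inj₁ u≡N) = inj₂ (inj₁ u≡N)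
    ... | inj₂ (inj₂ (0<u , u<N)) =
      inj₂ (inj₂ (trans (B≡A⊕d (a≤u , u≤b , 0<u , u<N)) (cong (_xor d) (onPath-inner {A} onA 0<u u<N))))
    gap′ : Gap B (s xor d) a b
    gap′ w a<w w<b Bw≡s⊕d = gap w a<w w<b (begin
      A w                ≡⟨ sym (xor-cancelʳ (A w) d) ⟩
      (A w xor d) xor d  ≡⟨ cong (_xor d) (trans (sym (B≡A⊕d iw)) Bw≡s⊕d) ⟩
      (s xor d) xor d    ≡⟨ xor-cancelʳ s d ⟩
      s                  ∎)
      where
      open ≡-Reasoning
      iw = <⇒≤ a<w , <⇒≤ w<b , ≤-<-trans z≤n a<w , <-≤-trans w<b b≤N

  constant⇒edge⇔ : 2 ≤ N → a < b → b ≤ N → Constant (A ⊕ B) a b → Edge A a b ⇔ Edge B a b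
  constant⇒edge⇔ {A = A} {B} 2≤N a<b b≤N c =
    mk⇔ (constant⇒edge 2≤N a<b b≤N c) (constant⇒edge 2≤N a<b b≤N (constant-⊕-comm {A} {B} c))

  gap-extendˡ : ∀ p → Gap L s p b → ∃ λ a → a ≤ p × OnPath L s a × Gap L s a b
  gap-extendˡ zero gap = 0 , ≤-refl , inj₁ refl , gap
  gap-extendˡ {L} {s} {b} (suc p) gap with onPath? L s (suc p)
  ... | yes on = suc p , ≤-refl , on , gap
  ... | no ¬on with gap-extendˡ p gap′
    where
    gap′ : Gap L s p b
    gap′ w p<w w<b with m≤n⇒m<n∨m≡n p<w
    ... | inj₁ sp<w = gap w sp<w w<b
    ... | inj₂ refl = λ Lw≡s → ¬on (inj₂ (inj₂ Lw≡s))
  ...   | a , a≤p , on , gap″ = a , m≤n⇒m≤1+n a≤p , on , gap″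

  gap-extendʳ : ∀ d q → q + d ≡ N → Gap L s a q → ∃ λ b → q ≤ b × b ≤ N × OnPath L s b × Gap L s a b
  gap-extendʳ zero q q+0≡N gap = q , ≤-refl , ≤-reflexive q≡N , inj₂ (inj₁ q≡N) , gap
    where q≡N = trans (sym (+-identityʳ q)) q+0≡N
  gap-extendʳ {L} {s} {a} (suc d) q q+sd≡N gap with onPath? L s q
  ... | yes on = q , ≤-refl , ≤-trans (m≤m+n q (suc d)) (≤-reflexive q+sd≡N) , on , gap
  ... | no ¬on with gap-extendʳ d (suc q) (trans (sym (+-suc q d)) q+sd≡N) gap′
    where
    gap′ : Gap L s a (suc q)
    gap′ w a<w w<sq with m≤n⇒m<n∨m≡n (s≤s⁻¹ w<sq)
    ... | inj₁ w<q = gap w a<w w<q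
    ... | inj₂ refl = λ Lw≡s → ¬on (inj₂ (inj₂ Lw≡s))
  ...   | b , sq≤b , b≤N , on , gap″ = b , ≤-trans (n≤1+n q) sq≤b , b≤N , on , gap″

  gap⇒edge : q ≤ N → Gap L s p q → ∃₂ λ a b → a ≤ p × q ≤ b × b ≤ N × Edge L a b
  gap⇒edge {q} {L} {s} {p} q≤N gap with gap-extendˡ p gap
  ... | a , a≤p , onA , gapˡ with gap-extendʳ (N ∸ q) q (m+[n∸m]≡n q≤N) gapˡ
  ...   | b , q≤b , b≤N , onB , gap′ = a , b , a≤p , q≤b , b≤N , s , onA , onB , gap′

  BlockProperty : (Z F G : ℕ → Bool) → Set
  BlockProperty Z F G = ∀ p m → p ≤ m → suc m ≤ N → Constant Z (suc p) m →
                        Constant F p (suc m) ⊎ Constant G p (suc m)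

  ForcesConstant : (F G Z : ℕ → Bool) → ℕ → ℕ → Set
  ForcesConstant F G Z a b = ∀ p q → a < p → q < b → Constant F p q → Constant G p q → Constant Z p q

  -- If F switches at r and G last switched at q < r, then F and G, hence Z, are
  -- constant on q+1, …, r, and the block property contradicts one of the two
  -- switches. Otherwise G is constant on a, …, r, and the block property for
  -- the empty block shows that G does not switch at r.
  sweep-step : BlockProperty Z F G → ForcesConstant F G Z a b → ∀ r → suc r ≤ b →
               Constant F a r → Constant F a (suc r) ⊎ Constant G a (suc r)
  sweep-step {F = F} {G} {a} block forces r sr≤b cF with step⊎switch F a r
  ... | inj₁ step = inj₁ (constant-extend cF step)
  ... | inj₂ (a≤r , swF@(0<r , sr<N , _)) with constant⊎lastSwitch G a r
  ...   | inj₁ cG = inj₂ (constant-extend cG λ _ _ →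
            [ (λ cF′ → contradiction cF′ (switch⇒¬constant swF ≤-refl ≤-refl))
            , constant⇒step 0<r sr<N ≤-refl ≤-refl
            ]′ (block r r ≤-refl (<⇒≤ sr<N) (constant-empty (n<1+n r))))
  ...   | inj₂ (q , a≤q , q<r , swG , cG) = ⊥-elim (
            [ switch⇒¬constant swF (<⇒≤ q<r) ≤-refl
            , switch⇒¬constant swG ≤-refl (s≤s (<⇒≤ q<r))
            ]′ (block q r (<⇒≤ q<r) (<⇒≤ sr<N)
                  (forces (suc q) r (s≤s a≤q) sr≤b (constant-mono (m≤n⇒m≤1+n a≤q) ≤-refl cF) cG)))

  sweep : BlockProperty Z F G → ForcesConstant F G Z a b → ∀ r → r ≤ b → Constant F a r ⊎ Constant G a r
  sweep block forces zero    _    = inj₁ constant-zero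
  sweep block forces (suc r) sr≤b with sweep block forces r (≤-trans (n≤1+n r) sr≤b)
  ... | inj₁ cF = sweep-step block forces r sr≤b cF
  ... | inj₂ cG = swap (sweep-step (λ p m p≤m sm≤N cZ → swap (block p m p≤m sm≤N cZ))
                                   (λ p q a<p q<b cG cF → forces p q a<p q<b cF cG) r sr≤b cG)

module Exchange (N : ℕ) (2≤N : 2 ≤ N) (X Y Z : ℕ → Bool)
  (covered : ∀ a b → a < b → b ≤ N → Labellings.Edge N Z a b →
             Labellings.Edge N X a b ⊎ Labellings.Edge N Y a b) where

  open Labellings N

  Z′ : ℕ → Bool
  Z′ = X ⊕ (Y ⊕ Z)

  private
    D D′ : ℕ → Bool
    D = X ⊕ Z
    D′ = Y ⊕ Z

  -- The Z-edge jumping over the block is an edge of X or of Y.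
  block : BlockProperty Z D D′
  block p m p≤m sm≤N cZ with gap⇒edge {s = not (Z (suc p))} sm≤N gap
    where
    gap : Gap Z (not (Z (suc p))) p (suc m)
    gap w p<w w<sm = not-¬ (cZ (p<w , w≤m , ≤-<-trans z≤n p<w , <-≤-trans w<sm sm≤N)
                               (≤-refl , sp≤m , s≤s z≤n , <-≤-trans (s≤s sp≤m) sm≤N))
      where
      w≤m = s≤s⁻¹ w<sm
      sp≤m = ≤-trans p<w w≤m
  ... | a , b , a≤p , sm≤b , b≤N , eZ with covered a b (≤-<-trans a≤p (<-≤-trans (s≤s p≤m) sm≤b)) b≤N eZ
  ...   | inj₁ eX = inj₁ (constant-mono a≤p sm≤b (edges⇒constant eX eZ))
  ...   | inj₂ eY = inj₂ (constant-mono a≤p sm≤b (edges⇒constant eY eZ))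

  private
    Y⊕Z′≗D : ∀ v → (Y ⊕ Z′) v ≡ D v
    Y⊕Z′≗D v = trans (cong (Y v xor_) (xor-leftComm (X v) (Y v) (Z v))) (xor-cancelˡ (Y v) (D v))

    X⊕Z′≗D′ : ∀ v → (X ⊕ Z′) v ≡ D′ v
    X⊕Z′≗D′ v = xor-cancelˡ (X v) (D′ v)

    Z′⊕Z≗D⊕D′ : ∀ v → (Z′ ⊕ Z) v ≡ (D ⊕ D′) v
    Z′⊕Z≗D⊕D′ v = begin
      (X v xor (Y v xor Z v)) xor Z v  ≡⟨ xor-assoc (X v) (D′ v) (Z v) ⟩
      X v xor ((Y v xor Z v) xor Z v)  ≡⟨ cong (X v xor_) (xor-comm (D′ v) (Z v)) ⟩
      X v xor (Z v xor (Y v xor Z v))  ≡⟨ sym (xor-assoc (X v) (Z v) (D′ v)) ⟩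
      (X v xor Z v) xor (Y v xor Z v)  ∎
      where open ≡-Reasoning

  -- W ⊕ Z is D, D′, 0 and D ⊕ D′ for W = X, Y, Z, Z′ respectively.
  Tracks : (ℕ → Bool) → Set
  Tracks W = ∀ {p q} → Constant D p q → Constant D′ p q → Constant (W ⊕ Z) p q

  X-tracks : Tracks X
  X-tracks cD _ = cD

  Y-tracks : Tracks Y
  Y-tracks _ cD′ = cD′

  Z-tracks : Tracks Z
  Z-tracks _ _ {v} {w} _ _ = trans (xor-same (Z v)) (sym (xor-same (Z w)))

  Z′-tracks : Tracks Z′
  Z′-tracks cD cD′ = constant-cong (sym ∘ Z′⊕Z≗D⊕D′) (constant-⊕ cD cD′)

  edge⇒forcesConstant : ∀ W {a b} → Tracks W → Edge W a b → ForcesConstant D D′ Z a b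
  edge⇒forcesConstant W tracks e p q a<p q<b cD cD′ =
    constant-cong (λ v → xor-cancelˡ (W v) (Z v))
                  (constant-⊕ (edge⇒constant-between e a<p q<b) (tracks cD cD′))

  no-edge : ∀ W {a b} → Tracks W → LastSwitch D a b → LastSwitch D′ a b → ¬ Edge W a b
  no-edge W {b = b} tracks swD swD′ e with sweep block (edge⇒forcesConstant W tracks e) b ≤-refl
  ... | inj₁ cD  = lastSwitch⇒¬constant swD cD
  ... | inj₂ cD′ = lastSwitch⇒¬constant swD′ cD′

  private
    edge⇔ : ∀ A B {a b} → a < b → b ≤ N → Constant (A ⊕ B) a b → Edge A a b ⇔ Edge B a b
    edge⇔ A B = constant⇒edge⇔ {A = A} {B = B} 2≤N

  exchange : ∀ a b → a < b → b ≤ N →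
             (Edge X a b ⇔ Edge Z a b) × (Edge Y a b ⇔ Edge Z′ a b) ⊎
             (Edge X a b ⇔ Edge Z′ a b) × (Edge Y a b ⇔ Edge Z a b)
  exchange a b a<b b≤N with constant⊎lastSwitch D a b | constant⊎lastSwitch D′ a b
  ... | inj₁ cD   | _         = inj₁ (edge⇔ X Z a<b b≤N cD ,
                                      edge⇔ Y Z′ a<b b≤N (constant-cong (sym ∘ Y⊕Z′≗D) cD))
  ... | inj₂ _    | inj₁ cD′  = inj₂ (edge⇔ X Z′ a<b b≤N (constant-cong (sym ∘ X⊕Z′≗D′) cD′) ,
                                      edge⇔ Y Z a<b b≤N cD′)
  ... | inj₂ swD  | inj₂ swD′ = inj₁ (¬⇒¬⇒⇔ (none X X-tracks) (none Z Z-tracks) ,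
                                      ¬⇒¬⇒⇔ (none Y Y-tracks) (none Z′ Z′-tracks))
    where none = λ W (tracks : Tracks W) → no-edge W tracks swD swD′

-- Pyramidal tours as labellings

injective⇒surjective : ∀ {n} {f : Fin n → Fin n} → Injective _≡_ _≡_ f → ∀ y → ∃ λ x → f x ≡ y
injective⇒surjective {suc m} {f} f-inj y with Finₚ.any? (λ x → f x Finₚ.≟ y)
... | yes hit = hit
... | no ¬hit = contradiction (Finₚ.injective⇒≤ g-inj) (<-irrefl refl)
  where
  g : Fin (suc m) → Fin m
  g x = punchOut {i = y} {j = f x} (λ y≡fx → ¬hit (x , sym y≡fx))
  g-inj : Injective _≡_ _≡_ g
  g-inj {x} {x′} =
    f-inj ∘ Finₚ.punchOut-injective {i = y} (λ e → ¬hit (x , sym e)) (λ e → ¬hit (x′ , sym e))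

next-position : ∀ {n} (i : Fin n) {m} → toℕ i < m → m ≤ n →
                suc (toℕ i) ≡ m ⊎ ∃ λ i′ → toℕ i′ ≡ suc (toℕ i) × toℕ i′ < m
next-position i i<m m≤n with m≤n⇒m<n∨m≡n i<m
... | inj₂ si≡m = inj₁ si≡m
... | inj₁ si<m = inj₂ (fromℕ< (<-≤-trans si<m m≤n) , i′≡si , subst (_< _) (sym i′≡si) si<m)
  where i′≡si = Finₚ.toℕ-fromℕ< (<-≤-trans si<m m≤n)

module PyramidalLabelling {n} {t : Tour n} (pyr : Pyramidal t) where

  open Labellings (n ∸ 1)

  private
    t-injective : IsHamiltonian t
    t-injective = proj₁ pyr

    t-start : ∀ i → toℕ i ≡ 0 → toℕ (t i) ≡ 0
    t-start = proj₁ (proj₂ pyr)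

  top : Fin n
  top = proj₁ (proj₂ (proj₂ pyr))

  value : Fin n → ℕ
  value i = toℕ (t i)

  private
    value-top : value top ≡ n ∸ 1
    value-top = proj₁ (proj₂ (proj₂ (proj₂ pyr)))

    ascending : ∀ i j → toℕ i < toℕ j → toℕ j ≤ toℕ top → value i < value j
    ascending = proj₁ (proj₂ (proj₂ (proj₂ (proj₂ pyr))))

    descending : ∀ i j → toℕ top ≤ toℕ i → toℕ i < toℕ j → value j < value i
    descending = proj₂ (proj₂ (proj₂ (proj₂ (proj₂ pyr))))

  position : Fin n → Fin n
  position v = proj₁ (injective⇒surjective t-injective v)

  t-position : ∀ v → t (position v) ≡ v
  t-position v = proj₂ (injective⇒surjective t-injective v)

  value-position : ∀ v → value (position v) ≡ toℕ v
  value-position v = cong toℕ (t-position v)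

  value-injective : ∀ {i j} → value i ≡ value j → i ≡ j
  value-injective = t-injective ∘ Finₚ.toℕ-injective

  value≡0 : ∀ i → value i ≡ 0 → toℕ i ≡ 0
  value≡0 i vi≡0 = trans (cong toℕ (value-injective (trans vi≡0 (sym (t-start i₀ i₀≡0))))) i₀≡0
    where
    i₀ = fromℕ< (≤-<-trans z≤n (Finₚ.toℕ<n i))
    i₀≡0 = Finₚ.toℕ-fromℕ< (≤-<-trans z≤n (Finₚ.toℕ<n i))

  value≡N : ∀ i → value i ≡ n ∸ 1 → i ≡ top
  value≡N i vi≡N = value-injective (trans vi≡N (sym value-top))

  ascending-reflects : ∀ i j → toℕ i ≤ toℕ top → toℕ j ≤ toℕ top →
                       value i < value j → toℕ i < toℕ j
  ascending-reflects i j i≤top j≤top vi<vj with <-cmp (toℕ i) (toℕ j)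
  ... | tri< i<j _ _ = i<j
  ... | tri≈ _ i≡j _ = contradiction vi<vj (<-irrefl (cong value (Finₚ.toℕ-injective i≡j)))
  ... | tri> _ _ j<i = contradiction (ascending j i j<i i≤top) (<-asym vi<vj)

  descending-reflects : ∀ i j → toℕ top ≤ toℕ i → toℕ top ≤ toℕ j →
                        value i < value j → toℕ j < toℕ i
  descending-reflects i j top≤i top≤j vi<vj with <-cmp (toℕ i) (toℕ j)
  ... | tri< i<j _ _ = contradiction (descending i j top≤i i<j) (<-asym vi<vj)
  ... | tri≈ _ i≡j _ = contradiction vi<vj (<-irrefl (cong value (Finₚ.toℕ-injective i≡j)))
  ... | tri> _ _ j<i = j<i

  OnAscent : ℕ → Set
  OnAscent v = ∃ λ i → toℕ i ≤ toℕ top × value i ≡ v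

  onAscent? : ∀ v → Dec (OnAscent v)
  onAscent? v = Finₚ.any? λ i → (toℕ i ≤? toℕ top) ×-dec (value i ≟ v)

  label : ℕ → Bool
  label v = does (onAscent? v)

  label-ascent : ∀ i → toℕ i ≤ toℕ top → label (value i) ≡ true
  label-ascent i i≤top = dec-true (onAscent? (value i)) (i , i≤top , refl)

  label-true : ∀ {w} → label w ≡ true → OnAscent w
  label-true {w} = does≡true⇒ (onAscent? w)

  label-true⇒ascent : ∀ i → label (value i) ≡ true → toℕ i ≤ toℕ top
  label-true⇒ascent i label≡true with label-true label≡true
  ... | i′ , i′≤top , vi′≡vi with value-injective vi′≡vi
  ...   | refl = i′≤top

  label-false⇒descent : ∀ i → label (value i) ≡ false → toℕ top < toℕ i
  label-false⇒descent i label≡false with toℕ i ≤? toℕ top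
  ... | yes i≤top = contradiction (i , i≤top , refl) (does≡false⇒¬ (onAscent? (value i)) label≡false)
  ... | no i≰top  = ≰⇒> i≰top

  label-descent : ∀ i → toℕ top < toℕ i → label (value i) ≡ false
  label-descent i top<i with label (value i) in eq
  ... | true  = contradiction (label-true⇒ascent i eq) (<⇒≱ top<i)
  ... | false = refl

  label-false : ∀ {w} → w < n → label w ≡ false → ∃ λ p → value p ≡ w × toℕ top < toℕ p
  label-false {w} w<n label≡false = p , vp≡w , label-false⇒descent p (trans (cong label vp≡w) label≡false)
    where
    p = position (fromℕ< w<n)
    vp≡w = trans (value-position (fromℕ< w<n)) (Finₚ.toℕ-fromℕ< w<n)

  ascent⇒onPath : ∀ i → toℕ i ≤ toℕ top → OnPath label true (value i)
  ascent⇒onPath i i≤top = inj₂ (inj₂ (label-ascent i i≤top))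

  descent⇒onPath : ∀ i → toℕ top ≤ toℕ i → OnPath label false (value i)
  descent⇒onPath i top≤i with m≤n⇒m<n∨m≡n top≤i
  ... | inj₁ top<i = inj₂ (inj₂ (label-descent i top<i))
  ... | inj₂ top≡i = inj₂ (inj₁ (subst (λ j → value j ≡ n ∸ 1) (Finₚ.toℕ-injective top≡i) value-top))

  onPath⇒ascent : ∀ i → OnPath label true (value i) → toℕ i ≤ toℕ top
  onPath⇒ascent i (inj₁ vi≡0)         = ≤-trans (≤-reflexive (value≡0 i vi≡0)) z≤n
  onPath⇒ascent i (inj₂ (inj₁ vi≡N))  = ≤-reflexive (cong toℕ (value≡N i vi≡N))
  onPath⇒ascent i (inj₂ (inj₂ label≡)) = label-true⇒ascent i label≡

  onPath⇒descent : ∀ i → OnPath label false (value i) → value i ≡ 0 ⊎ toℕ top ≤ toℕ i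
  onPath⇒descent i (inj₁ vi≡0)         = inj₁ vi≡0
  onPath⇒descent i (inj₂ (inj₁ vi≡N))  = inj₂ (≤-reflexive (cong toℕ (sym (value≡N i vi≡N))))
  onPath⇒descent i (inj₂ (inj₂ label≡)) = inj₂ (<⇒≤ (label-false⇒descent i label≡))

  ascending-step-edge : ∀ i j → suc (toℕ i) ≡ toℕ j → toℕ j ≤ toℕ top → Edge label (value i) (value j)
  ascending-step-edge i j si≡j j≤top = true , ascent⇒onPath i i≤top , ascent⇒onPath j j≤top , gap
    where
    i≤top = ≤-trans (n≤1+n _) (≤-trans (≤-reflexive si≡j) j≤top)
    gap : Gap label true (value i) (value j)
    gap w vi<w w<vj label≡true with label-true label≡true
    ... | p , p≤top , refl =
      contradiction (ascending-reflects p j p≤top j≤top w<vj)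
                    (≤⇒≯ (≤-trans (≤-reflexive (sym si≡j)) (ascending-reflects i p i≤top p≤top vi<w)))

  descending-step-edge : ∀ i j → suc (toℕ i) ≡ toℕ j → toℕ top ≤ toℕ i → Edge label (value j) (value i)
  descending-step-edge i j si≡j top≤i = false , descent⇒onPath j top≤j , descent⇒onPath i top≤i , gap
    where
    top≤j = ≤-trans top≤i (≤-trans (n≤1+n _) (≤-reflexive si≡j))
    gap : Gap label false (value j) (value i)
    gap w vj<w w<vi label≡false with label-false (<-trans w<vi (Finₚ.toℕ<n (t i))) label≡false
    ... | p , refl , top<p =
      contradiction (descending-reflects p i (<⇒≤ top<p) top≤i w<vi)
                    (≤⇒≯ (s≤s⁻¹ (≤-trans (descending-reflects j p top≤j (<⇒≤ top<p) vj<w)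
                                         (≤-reflexive (sym si≡j)))))

  closing-edge : ∀ i j → suc (toℕ i) ≡ n → toℕ j ≡ 0 → Edge label (value j) (value i)
  closing-edge i j si≡n j≡0 = false , inj₁ (t-start j j≡0) , descent⇒onPath i top≤i , gap
    where
    top≤i = s≤s⁻¹ (≤-trans (Finₚ.toℕ<n top) (≤-reflexive (sym si≡n)))
    gap : Gap label false (value j) (value i)
    gap w _ w<vi label≡false with label-false (<-trans w<vi (Finₚ.toℕ<n (t i))) label≡false
    ... | p , refl , top<p =
      contradiction (≤-trans (≤-reflexive (sym si≡n)) (descending-reflects p i (<⇒≤ top<p) top≤i w<vi))
                    (<⇒≱ (Finₚ.toℕ<n p))

  consecutive-increasing : ∀ {i j} → CycSucc i j → value i < value j → Edge label (value i) (value j)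
  consecutive-increasing {i} {j} (inj₁ si≡j) vi<vj with toℕ j ≤? toℕ top
  ... | yes j≤top = ascending-step-edge i j si≡j j≤top
  ... | no  j≰top = contradiction (descending i j top≤i (≤-reflexive si≡j)) (<-asym vi<vj)
    where top≤i = s≤s⁻¹ (≤-trans (≰⇒> j≰top) (≤-reflexive (sym si≡j)))
  consecutive-increasing {i} {j} (inj₂ (_ , j≡0)) vi<vj =
    contradiction (subst (value i <_) (t-start j j≡0) vi<vj) n≮0

  consecutive-decreasing : ∀ {i j} → CycSucc i j → value j < value i → Edge label (value j) (value i)
  consecutive-decreasing {i} {j} (inj₁ si≡j) vj<vi with toℕ j ≤? toℕ top
  ... | yes j≤top = contradiction (ascending i j (≤-reflexive si≡j) j≤top) (<-asym vj<vi)
  ... | no  j≰top =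
    descending-step-edge i j si≡j (s≤s⁻¹ (≤-trans (≰⇒> j≰top) (≤-reflexive (sym si≡j))))
  consecutive-decreasing {i} {j} (inj₂ (si≡n , j≡0)) _ = closing-edge i j si≡n j≡0

  tourEdge⇒edge : ∀ {a b} → toℕ a < toℕ b → TourEdge t a b → Edge label (toℕ a) (toℕ b)
  tourEdge⇒edge a<b (i , j , cs , inj₁ (refl , refl)) = consecutive-increasing cs a<b
  tourEdge⇒edge a<b (i , j , cs , inj₂ (refl , refl)) = consecutive-decreasing cs a<b

  ascending-gap⇒step : ∀ i j → toℕ i ≤ toℕ top → toℕ j ≤ toℕ top → value i < value j →
                       Gap label true (value i) (value j) → suc (toℕ i) ≡ toℕ j
  ascending-gap⇒step i j i≤top j≤top vi<vj gap
    with next-position i (ascending-reflects i j i≤top j≤top vi<vj) (<⇒≤ (Finₚ.toℕ<n j))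
  ... | inj₁ si≡j = si≡j
  ... | inj₂ (i′ , i′≡si , i′<j) =
    contradiction (label-ascent i′ i′≤top)
                  (gap (value i′) (ascending i i′ (≤-reflexive (sym i′≡si)) i′≤top) (ascending i′ j i′<j j≤top))
    where i′≤top = ≤-trans (<⇒≤ i′<j) j≤top

  descending-gap⇒step : ∀ i j → toℕ top ≤ toℕ i → toℕ top ≤ toℕ j → value i < value j →
                        Gap label false (value i) (value j) → suc (toℕ j) ≡ toℕ i
  descending-gap⇒step i j top≤i top≤j vi<vj gap
    with next-position j (descending-reflects i j top≤i top≤j vi<vj) (<⇒≤ (Finₚ.toℕ<n i))
  ... | inj₁ sj≡i = sj≡i
  ... | inj₂ (i′ , i′≡sj , i′<i) =
    contradiction (label-descent i′ top<i′)
                  (gap (value i′) (descending i′ i (<⇒≤ top<i′) i′<i) (descending j i′ top≤j j<i′))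
    where j<i′ = ≤-reflexive (sym i′≡sj)
          top<i′ = ≤-<-trans top≤j j<i′

  closing-gap⇒step : ∀ i j → value i ≡ 0 → toℕ top ≤ toℕ j →
                     Gap label false (value i) (value j) → suc (toℕ j) ≡ n
  closing-gap⇒step i j vi≡0 top≤j gap with next-position j (Finₚ.toℕ<n j) ≤-refl
  ... | inj₁ sj≡n = sj≡n
  ... | inj₂ (i′ , i′≡sj , _) =
    contradiction (label-descent i′ top<i′) (gap (value i′) vi<vi′ (descending j i′ top≤j j<i′))
    where j<i′ = ≤-reflexive (sym i′≡sj)
          top<i′ = ≤-<-trans top≤j j<i′
          vi<vi′ : value i < value i′
          vi<vi′ with value i′ ≟ 0
          ... | yes vi′≡0 = contradiction (trans (sym i′≡sj) (value≡0 i′ vi′≡0)) (λ ())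
          ... | no  vi′≢0 = subst (_< value i′) (sym vi≡0) (n≢0⇒n>0 vi′≢0)

  edge⇒consecutive : ∀ i j → value i < value j → Edge label (value i) (value j) → TourEdge t (t i) (t j)
  edge⇒consecutive i j vi<vj (true , onI , onJ , gap) =
    i , j , inj₁ (ascending-gap⇒step i j (onPath⇒ascent i onI) (onPath⇒ascent j onJ) vi<vj gap) ,
    inj₁ (refl , refl)
  edge⇒consecutive i j vi<vj (false , onI , onJ , gap) with onPath⇒descent i onI | onPath⇒descent j onJ
  ... | _          | inj₁ vj≡0  = contradiction (subst (value i <_) vj≡0 vi<vj) n≮0
  ... | inj₁ vi≡0  | inj₂ top≤j =
    j , i , inj₂ (closing-gap⇒step i j vi≡0 top≤j gap , value≡0 i vi≡0) , inj₂ (refl , refl)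
  ... | inj₂ top≤i | inj₂ top≤j =
    j , i , inj₁ (descending-gap⇒step i j top≤i top≤j vi<vj gap) , inj₂ (refl , refl)

  edge⇒tourEdge : ∀ {a b} → toℕ a < toℕ b → Edge label (toℕ a) (toℕ b) → TourEdge t a b
  edge⇒tourEdge {a} {b} a<b e = subst₂ (TourEdge t) (t-position a) (t-position b)
    (edge⇒consecutive (position a) (position b) (subst₂ _<_ va vb a<b) (subst₂ (Edge label) va vb e))
    where va = sym (value-position a)
          vb = sym (value-position b)

  tourEdge⇔edge : ∀ {a b} → toℕ a < toℕ b → TourEdge t a b ⇔ Edge label (toℕ a) (toℕ b)
  tourEdge⇔edge a<b = mk⇔ (tourEdge⇒edge a<b) (edge⇒tourEdge a<b)

-- The pyramidal tour of a labelling

count : (ℕ → Bool) → ℕ → ℕ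
count f zero    = 0
count f (suc m) = if f m then suc (count f m) else count f m

count-step : ∀ f m → count f m ≤ count f (suc m)
count-step f m with f m
... | true  = n≤1+n _
... | false = ≤-refl

count-mono : ∀ f {v w} → v ≤ w → count f v ≤ count f w
count-mono f {w = zero} z≤n = ≤-refl
count-mono f {v} {suc w} v≤sw with m≤n⇒m<n∨m≡n v≤sw
... | inj₁ v<sw = ≤-trans (count-mono f (s≤s⁻¹ v<sw)) (count-step f w)
... | inj₂ refl = ≤-refl

count-strict : ∀ f {v w} → v < w → f v ≡ true → count f v < count f w
count-strict f {v} v<w fv≡true =
  ≤-trans (≤-reflexive (cong (λ b → if b then suc (count f v) else count f v) (sym fv≡true)))
          (count-mono f v<w)

count-reflects-< : ∀ f {v w} → count f v < count f w → v < w
count-reflects-< f cv<cw = ≰⇒> λ w≤v → <⇒≱ cv<cw (count-mono f w≤v)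

count≤ : ∀ f m → count f m ≤ m
count≤ f zero = z≤n
count≤ f (suc m) with f m
... | true  = s≤s (count≤ f m)
... | false = m≤n⇒m≤1+n (count≤ f m)

count-complement : ∀ f m → count f m + count (not ∘ f) m ≡ m
count-complement f zero = refl
count-complement f (suc m) with f m
... | true  = cong suc (count-complement f m)
... | false = trans (+-suc (count f m) _) (cong suc (count-complement f m))

module FromLabelling (N : ℕ) (L : ℕ → Bool) where

  ascends : ℕ → Bool
  ascends v = does (v ≟ 0) ∨ does (v ≟ N) ∨ L v

  descends : ℕ → Bool
  descends = not ∘ ascends

  ascends-N : ascends N ≡ true
  ascends-N = trans (cong (λ b → does (N ≟ 0) ∨ b ∨ L N) (dec-true (N ≟ N) refl)) (∨-zeroʳ _)

  ascends-inner : ∀ {v} → 0 < v → v < N → ascends v ≡ L v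
  ascends-inner {v} 0<v v<N =
    cong₂ (λ b c → b ∨ c ∨ L v) (dec-false (v ≟ 0) (>⇒≢ 0<v)) (dec-false (v ≟ N) (<⇒≢ v<N))

  -- The tour lists the ascending vertices in increasing order, then the
  -- others in decreasing order: this is the position of vertex v.
  place : ℕ → ℕ
  place v = if ascends v then count ascends v else N ∸ count descends v

  place-ascends : ∀ v → ascends v ≡ true → place v ≡ count ascends v
  place-ascends v eq = cong (λ b → if b then count ascends v else N ∸ count descends v) eq

  place-descends : ∀ v → ascends v ≡ false → place v ≡ N ∸ count descends v
  place-descends v eq = cong (λ b → if b then count ascends v else N ∸ count descends v) eq

  ascents : ℕ
  ascents = count ascends (suc N)

  place<ascents : ∀ {v} → v ≤ N → ascends v ≡ true → place v < ascents
  place<ascents {v} v≤N up = subst (_< ascents) (sym (place-ascends v up)) (count-strict ascends (s≤s v≤N) up)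

  ascents≤place : ∀ {v} → v ≤ N → ascends v ≡ false → ascents ≤ place v
  ascents≤place {v} v≤N down =
    subst (ascents ≤_) (sym (place-descends v down)) (m+n≤o⇒m≤o∸n ascents (s≤s⁻¹ (begin
    suc (ascents + count descends v)  ≡⟨ sym (+-suc ascents _) ⟩
    ascents + suc (count descends v)  ≤⟨ +-monoʳ-≤ ascents (count-strict descends (s≤s v≤N) (cong not down)) ⟩
    ascents + count descends (suc N)  ≡⟨ count-complement ascends (suc N) ⟩
    suc N                             ∎)))
    where open ≤-Reasoning

  place≤N : ∀ {v} → v ≤ N → place v ≤ N
  place≤N {v} v≤N with ascends v
  ... | true  = ≤-trans (count≤ ascends v) v≤N
  ... | false = m∸n≤m N (count descends v)

  place-injective< : ∀ {v w} → v < w → w ≤ N → place v ≢ place w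
  place-injective< {v} {w} v<w w≤N pv≡pw with true⊎false (ascends v) | true⊎false (ascends w)
  ... | inj₁ up-v | inj₁ up-w =
    <-irrefl (trans (sym (place-ascends v up-v)) (trans pv≡pw (place-ascends w up-w)))
             (count-strict ascends v<w up-v)
  ... | inj₁ up-v | inj₂ up-w =
    <-irrefl pv≡pw (<-≤-trans (place<ascents v≤N up-v) (ascents≤place w≤N up-w))
    where v≤N = ≤-trans (<⇒≤ v<w) w≤N
  ... | inj₂ up-v | inj₁ up-w =
    <-irrefl (sym pv≡pw) (<-≤-trans (place<ascents w≤N up-w) (ascents≤place v≤N up-v))
    where v≤N = ≤-trans (<⇒≤ v<w) w≤N
  ... | inj₂ up-v | inj₂ up-w =
    <-irrefl (trans (sym (place-descends w up-w)) (trans (sym pv≡pw) (place-descends v up-v)))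
             (∸-monoʳ-< (count-strict descends v<w (cong not up-v)) (≤-trans (count≤ descends w) w≤N))

  place-injective : ∀ {v w} → v ≤ N → w ≤ N → place v ≡ place w → v ≡ w
  place-injective {v} {w} v≤N w≤N pv≡pw with <-cmp v w
  ... | tri< v<w _ _ = contradiction pv≡pw (place-injective< v<w w≤N)
  ... | tri≈ _ v≡w _ = v≡w
  ... | tri> _ _ w<v = contradiction (sym pv≡pw) (place-injective< w<v v≤N)

  top<ascents : count ascends N < ascents
  top<ascents = count-strict ascends {N} ≤-refl ascends-N

  ascends⇒place≤top : ∀ {v} → v ≤ N → ascends v ≡ true → place v ≤ count ascends N
  ascends⇒place≤top {v} v≤N up = ≤-trans (≤-reflexive (place-ascends v up)) (count-mono ascends v≤N)

  place≤top⇒ascends : ∀ {v} → v ≤ N → place v ≤ count ascends N → ascends v ≡ true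
  place≤top⇒ascends {v} v≤N pv≤top with true⊎false (ascends v)
  ... | inj₁ up   = up
  ... | inj₂ down = contradiction (<-≤-trans top<ascents (ascents≤place v≤N down)) (≤⇒≯ pv≤top)

  top≤place⇒N : ∀ {v} → v ≤ N → ascends v ≡ true → count ascends N ≤ place v → v ≡ N
  top≤place⇒N {v} v≤N up top≤pv = ≤-antisym v≤N (≮⇒≥ λ v<N →
    <⇒≱ (count-strict ascends v<N up) (≤-trans top≤pv (≤-reflexive (place-ascends v up))))

  placeFin : Fin (suc N) → Fin (suc N)
  placeFin v = fromℕ< (s≤s (place≤N (Finₚ.toℕ≤pred[n] v)))

  toℕ-placeFin : ∀ v → toℕ (placeFin v) ≡ place (toℕ v)
  toℕ-placeFin v = Finₚ.toℕ-fromℕ< _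

  placeFin-injective : Injective _≡_ _≡_ placeFin
  placeFin-injective {v} {w} eq = Finₚ.toℕ-injective
    (place-injective (Finₚ.toℕ≤pred[n] v) (Finₚ.toℕ≤pred[n] w)
                     (trans (sym (toℕ-placeFin v)) (trans (cong toℕ eq) (toℕ-placeFin w))))

  tour : Tour (suc N)
  tour i = proj₁ (injective⇒surjective placeFin-injective i)

  placeFin-tour : ∀ i → placeFin (tour i) ≡ i
  placeFin-tour i = proj₂ (injective⇒surjective placeFin-injective i)

  tour-placeFin : ∀ v → tour (placeFin v) ≡ v
  tour-placeFin v = placeFin-injective (placeFin-tour (placeFin v))

  private
    vt : Fin (suc N) → ℕ
    vt i = toℕ (tour i)

    vt≤N : ∀ i → vt i ≤ N
    vt≤N i = Finₚ.toℕ≤pred[n] (tour i)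

  place-tour : ∀ i → place (vt i) ≡ toℕ i
  place-tour i = trans (sym (toℕ-placeFin (tour i))) (cong toℕ (placeFin-tour i))

  top : Fin (suc N)
  top = placeFin (fromℕ N)

  toℕ-top : toℕ top ≡ count ascends N
  toℕ-top = trans (toℕ-placeFin (fromℕ N)) (trans (cong place (Finₚ.toℕ-fromℕ N)) (place-ascends N ascends-N))

  tour-injective : IsHamiltonian tour
  tour-injective {i} {j} eq = trans (sym (placeFin-tour i)) (trans (cong placeFin eq) (placeFin-tour j))

  tour-start : ∀ i → toℕ i ≡ 0 → vt i ≡ 0
  tour-start i i≡0 = place-injective (vt≤N i) z≤n (trans (place-tour i) i≡0)

  tour-top : vt top ≡ N
  tour-top = trans (cong toℕ (tour-placeFin (fromℕ N))) (Finₚ.toℕ-fromℕ N)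

  tour-ascending : ∀ i j → toℕ i < toℕ j → toℕ j ≤ toℕ top → vt i < vt j
  tour-ascending i j i<j j≤top = count-reflects-< ascends (begin-strict
    count ascends (vt i)  ≡⟨ sym (place-ascends (vt i) (ascends-below i (<⇒≤ (<-≤-trans i<j j≤top)))) ⟩
    place (vt i)          ≡⟨ place-tour i ⟩
    toℕ i                 <⟨ i<j ⟩
    toℕ j                 ≡⟨ sym (place-tour j) ⟩
    place (vt j)          ≡⟨ place-ascends (vt j) (ascends-below j j≤top) ⟩
    count ascends (vt j)  ∎)
    where
    open ≤-Reasoning
    ascends-below : ∀ k → toℕ k ≤ toℕ top → ascends (vt k) ≡ true
    ascends-below k k≤top =
      place≤top⇒ascends (vt≤N k)
        (≤-trans (≤-reflexive (place-tour k)) (≤-trans k≤top (≤-reflexive toℕ-top)))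

  tour-descending : ∀ i j → toℕ top ≤ toℕ i → toℕ i < toℕ j → vt j < vt i
  tour-descending i j top≤i i<j with true⊎false (ascends (vt j)) | true⊎false (ascends (vt i))
  ... | inj₁ up-j   | _         = contradiction (ascends⇒place≤top (vt≤N j) up-j) (<⇒≱ top<pj)
    where top<pj = subst₂ _<_ toℕ-top (sym (place-tour j)) (≤-<-trans top≤i i<j)
  ... | inj₂ down-j | inj₁ up-i = subst (vt j <_) (sym vi≡N) (≤∧≢⇒< (vt≤N j) vj≢N)
    where
    vi≡N = top≤place⇒N (vt≤N i) up-i (subst₂ _≤_ toℕ-top (sym (place-tour i)) top≤i)
    vj≢N : vt j ≢ N
    vj≢N vj≡N = contradiction (trans (sym down-j) (trans (cong ascends vj≡N) ascends-N)) λ ()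
  ... | inj₂ down-j | inj₂ down-i = count-reflects-< descends (∸-cancelʳ-< {o = N} (begin-strict
    N ∸ count descends (vt i)  ≡⟨ sym (place-descends (vt i) down-i) ⟩
    place (vt i)               ≡⟨ place-tour i ⟩
    toℕ i                      <⟨ i<j ⟩
    toℕ j                      ≡⟨ sym (place-tour j) ⟩
    place (vt j)               ≡⟨ place-descends (vt j) down-j ⟩
    N ∸ count descends (vt j)  ∎))
    where open ≤-Reasoning

  tour-pyramidal : Pyramidal tour
  tour-pyramidal = tour-injective , tour-start , top , tour-top , tour-ascending , tour-descending

  private module T = PyramidalLabelling tour-pyramidal
  open T public using (label; tourEdge⇔edge)

  label-tour : ∀ {v} → 0 < v → v < N → label v ≡ L v
  label-tour {v} 0<v v<N = trans (cong label (sym vi≡v)) (trans label-i (ascends-inner 0<v v<N))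
    where
    v<sN = s≤s (<⇒≤ v<N)
    i = placeFin (fromℕ< v<sN)
    vi≡v : vt i ≡ v
    vi≡v = trans (cong toℕ (tour-placeFin (fromℕ< v<sN))) (Finₚ.toℕ-fromℕ< v<sN)
    i≡pv : toℕ i ≡ place v
    i≡pv = trans (toℕ-placeFin (fromℕ< v<sN)) (cong place (Finₚ.toℕ-fromℕ< v<sN))
    label-i : label (vt i) ≡ ascends v
    label-i with true⊎false (ascends v)
    ... | inj₁ up   = trans (T.label-ascent i (subst₂ _≤_ (sym i≡pv) (sym toℕ-top)
                                                         (ascends⇒place≤top (<⇒≤ v<N) up))) (sym up)
    ... | inj₂ down = trans (T.label-descent i (subst₂ _<_ (sym toℕ-top) (sym i≡pv)
                                                          (<-≤-trans top<ascents (ascents≤place (<⇒≤ v<N) down))))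
                            (sym down)

-- Characteristic vectors and linear functionals

private variable
  n : ℕ
  t : Tour n
  a b : Fin n

tourEdge-sym : TourEdge t a b → TourEdge t b a
tourEdge-sym (i , j , i→j , inj₁ (ti≡a , tj≡b)) = i , j , i→j , inj₂ (ti≡a , tj≡b)
tourEdge-sym (i , j , i→j , inj₂ (ti≡b , tj≡a)) = i , j , i→j , inj₁ (ti≡b , tj≡a)

cycSucc-irrefl : ∀ {i : Fin n} → 2 ≤ n → ¬ CycSucc i i
cycSucc-irrefl _   (inj₁ si≡i) = <-irrefl (sym si≡i) (n<1+n _)
cycSucc-irrefl 2≤n (inj₂ (si≡n , i≡0)) =
  <-irrefl refl (≤-trans 2≤n (≤-reflexive (trans (sym si≡n) (cong suc i≡0))))

tourEdge-irrefl : ∀ {n} {t : Tour n} {a} → 2 ≤ n → IsHamiltonian t → ¬ TourEdge t a a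
tourEdge-irrefl {t = t} {a} 2≤n t-inj (i , j , i→j , ends) =
  cycSucc-irrefl 2≤n (subst (CycSucc i) (sym (t-inj (same-end ends))) i→j)
  where
  same-end : (t i ≡ a × t j ≡ a) ⊎ (t i ≡ a × t j ≡ a) → t i ≡ t j
  same-end (inj₁ (ti≡a , tj≡a)) = trans ti≡a (sym tj≡a)
  same-end (inj₂ (ti≡a , tj≡a)) = trans ti≡a (sym tj≡a)

χ-¬edge : ¬ TourEdge t a b → χ t a b ≡ 0
χ-¬edge {t = t} {a} {b} ¬e = cong (if_then 1 else 0) (dec-false (tourEdge? t a b) ¬e)

χ-cong : ∀ {n} {s t : Tour n} {a b c d} → TourEdge s a b ⇔ TourEdge t c d → χ s a b ≡ χ t c d
χ-cong {s = s} {t} {a} {b} {c} {d} s⇔t with tourEdge? s a b | tourEdge? t c d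
... | yes _  | yes _  = refl
... | no _   | no _   = refl
... | yes es | no ¬et = contradiction (Equivalence.to s⇔t es) ¬et
... | no ¬es | yes et = contradiction (Equivalence.from s⇔t et) ¬es

χ-sym : ∀ (t : Tour n) a b → χ t a b ≡ χ t b a
χ-sym t a b = χ-cong (mk⇔ (tourEdge-sym {t = t} {a = a} {b = b}) (tourEdge-sym {t = t} {a = b} {b = a}))

sameTour-from-< : ∀ {n} {s t : Tour n} → 2 ≤ n → IsHamiltonian s → IsHamiltonian t →
                  (∀ a b → toℕ a < toℕ b → χ s a b ≡ χ t a b) → SameTour s t
sameTour-from-< {s = s} {t} 2≤n s-inj t-inj agree a b with <-cmp (toℕ a) (toℕ b)
... | tri< a<b _ _ = agree a b a<b
... | tri> _ _ b<a = trans (χ-sym s a b) (trans (agree b a b<a) (χ-sym t b a))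
... | tri≈ _ a≡b _ rewrite Finₚ.toℕ-injective a≡b =
  trans (χ-¬edge (tourEdge-irrefl 2≤n s-inj)) (sym (χ-¬edge (tourEdge-irrefl 2≤n t-inj)))

module _ {n} {s t : Tour n} (s≗t : s ≗ t) where

  tourEdge-resp : ∀ {a b} → TourEdge s a b → TourEdge t a b
  tourEdge-resp (i , j , i→j , inj₁ (si≡a , sj≡b)) =
    i , j , i→j , inj₁ (trans (sym (s≗t i)) si≡a , trans (sym (s≗t j)) sj≡b)
  tourEdge-resp (i , j , i→j , inj₂ (si≡b , sj≡a)) =
    i , j , i→j , inj₂ (trans (sym (s≗t i)) si≡b , trans (sym (s≗t j)) sj≡a)

  pyramidal-resp : Pyramidal s → Pyramidal t
  pyramidal-resp (s-inj , start , k , top , asc , desc) =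
    (λ {i} {j} ti≡tj → s-inj (trans (s≗t i) (trans ti≡tj (sym (s≗t j))))) ,
    (λ i i≡0 → subst (λ v → toℕ v ≡ 0) (s≗t i) (start i i≡0)) ,
    k , trans (cong toℕ (sym (s≗t k))) top ,
    (λ i j i<j j≤k → subst₂ (λ u v → toℕ u < toℕ v) (s≗t i) (s≗t j) (asc i j i<j j≤k)) ,
    (λ i j k≤i i<j → subst₂ (λ u v → toℕ u < toℕ v) (s≗t j) (s≗t i) (desc i j k≤i i<j))

χ-resp : ∀ {n} {s t : Tour n} → s ≗ t → ∀ a b → χ s a b ≡ χ t a b
χ-resp s≗t a b = χ-cong (mk⇔ (tourEdge-resp s≗t) (tourEdge-resp (sym ∘ s≗t)))

sumFin≡sum : ∀ {n} (f : Fin n → ℚ) → sumFin f ≡ sum f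
sumFin≡sum {zero}  f = refl
sumFin≡sum {suc n} f = cong (ℚ._+_ (f Fin.zero)) (sumFin≡sum (f ∘ Fin.suc))

sumFin-+ : ∀ {n} (f g : Fin n → ℚ) → sumFin (λ i → f i ℚ.+ g i) ≡ sumFin f ℚ.+ sumFin g
sumFin-+ f g = begin
  sumFin (λ i → f i ℚ.+ g i)  ≡⟨ sumFin≡sum (λ i → f i ℚ.+ g i) ⟩
  sum (λ i → f i ℚ.+ g i)     ≡⟨ ∑-distrib-+ f g ⟩
  sum f ℚ.+ sum g             ≡⟨ sym (cong₂ ℚ._+_ (sumFin≡sum f) (sumFin≡sum g)) ⟩
  sumFin f ℚ.+ sumFin g       ∎
  where open ≡-Reasoning

sumFin-cong : ∀ {n} {f g : Fin n → ℚ} → (∀ i → f i ≡ g i) → sumFin f ≡ sumFin g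
sumFin-cong {f = f} {g} f≗g = trans (sumFin≡sum f) (trans (sum-cong-≗ f≗g) (sym (sumFin≡sum g)))

sumFin-+-cong : ∀ {n} {f g h k : Fin n → ℚ} → (∀ i → f i ℚ.+ g i ≡ h i ℚ.+ k i) →
                sumFin f ℚ.+ sumFin g ≡ sumFin h ℚ.+ sumFin k
sumFin-+-cong {f = f} {g} {h} {k} eq = trans (sym (sumFin-+ f g)) (trans (sumFin-cong eq) (sumFin-+ h k))

sumFin-≤0 : ∀ {n} {f : Fin n → ℚ} → (∀ i → f i ℚ.≤ 0ℚ) → sumFin f ℚ.≤ 0ℚ
sumFin-≤0 {zero}  _   = ℚₚ.≤-refl
sumFin-≤0 {suc n} f≤0 = ℚₚ.+-mono-≤ (f≤0 Fin.zero) (sumFin-≤0 (f≤0 ∘ Fin.suc))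

sumFin-<0 : ∀ {n} {f : Fin n → ℚ} → (∀ i → f i ℚ.≤ 0ℚ) → ∀ j → f j ℚ.< 0ℚ → sumFin f ℚ.< 0ℚ
sumFin-<0 {suc n} f≤0 Fin.zero    fj<0 = ℚₚ.+-mono-<-≤ fj<0 (sumFin-≤0 (f≤0 ∘ Fin.suc))
sumFin-<0 {suc n} f≤0 (Fin.suc j) fj<0 = ℚₚ.+-mono-≤-< (f≤0 Fin.zero) (sumFin-<0 (f≤0 ∘ Fin.suc) j fj<0)

sumFin-0 : ∀ {n} {f : Fin n → ℚ} → (∀ i → f i ≡ 0ℚ) → sumFin f ≡ 0ℚ
sumFin-0 {zero}  _   = refl
sumFin-0 {suc n} f≡0 = cong₂ ℚ._+_ (f≡0 Fin.zero) (sumFin-0 (f≡0 ∘ Fin.suc))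

when : ∀ {P : Set} → Dec P → ℚ → ℚ
when d q = if does d then q else 0ℚ

when-+ : ∀ {P : Set} (d : Dec P) {p q r s : ℚ} → (P → p ℚ.+ q ≡ r ℚ.+ s) →
         when d p ℚ.+ when d q ≡ when d r ℚ.+ when d s
when-+ (yes p) eq = eq p
when-+ (no _)  _  = refl

when-≤0 : ∀ {P : Set} (d : Dec P) {q} → q ℚ.≤ 0ℚ → when d q ℚ.≤ 0ℚ
when-≤0 (yes _) q≤0 = q≤0
when-≤0 (no _)  _   = ℚₚ.≤-refl

when-≡0 : ∀ {P : Set} (d : Dec P) {q} → q ≡ 0ℚ → when d q ≡ 0ℚ
when-≡0 (yes _) q≡0 = q≡0
when-≡0 (no _)  _   = refl

when-yes : ∀ {P : Set} (d : Dec P) {q} → P → when d q ≡ q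
when-yes (yes _) _ = refl
when-yes (no ¬p) p = contradiction p ¬p

⟦_⟧ : ℕ → ℚ
⟦ m ⟧ = (+ m) ℚ./ 1

-- Definitionally the summand in c ·χ t.
weight : (Fin n → Fin n → ℚ) → Tour n → Fin n → Fin n → ℚ
weight c t a b = when (toℕ a <? toℕ b) (c a b ℚ.* ⟦ χ t a b ⟧)

Exchanged : Tour n → Tour n → Tour n → Tour n → Set
Exchanged x y z z′ = ∀ a b → toℕ a < toℕ b →
  (χ x a b ≡ χ z a b × χ y a b ≡ χ z′ a b) ⊎ (χ x a b ≡ χ z′ a b × χ y a b ≡ χ z a b)

·χ-exchanged : ∀ {n} {x y z z′ : Tour n} → Exchanged x y z z′ →
               ∀ c → (c ·χ z) ℚ.+ (c ·χ z′) ≡ (c ·χ x) ℚ.+ (c ·χ y)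
·χ-exchanged {x = x} {y} {z} {z′} exch c = sumFin-+-cong λ a → sumFin-+-cong λ b → weights a b
  where
  term : ∀ a b → ℕ → ℚ
  term a b m = c a b ℚ.* ⟦ m ⟧
  weights : ∀ a b → weight c z a b ℚ.+ weight c z′ a b ≡ weight c x a b ℚ.+ weight c y a b
  weights a b = when-+ (toℕ a <? toℕ b) λ a<b → terms (exch a b a<b)
    where
    terms : (χ x a b ≡ χ z a b × χ y a b ≡ χ z′ a b) ⊎ (χ x a b ≡ χ z′ a b × χ y a b ≡ χ z a b) →
            term a b (χ z a b) ℚ.+ term a b (χ z′ a b) ≡ term a b (χ x a b) ℚ.+ term a b (χ y a b)
    terms (inj₁ (x≡z , y≡z′)) = cong₂ ℚ._+_ (cong (term a b) (sym x≡z)) (cong (term a b) (sym y≡z′))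
    terms (inj₂ (x≡z′ , y≡z)) = trans (ℚₚ.+-comm (term a b (χ z a b)) _)
                                      (cong₂ ℚ._+_ (cong (term a b) (sym x≡z′)) (cong (term a b) (sym y≡z)))

exchanged-sameTour : ∀ {n} {x y z z′ : Tour n} → 2 ≤ n → IsHamiltonian y → IsHamiltonian z →
                     Exchanged x y z z′ → SameTour z′ x → SameTour z y
exchanged-sameTour {x = x} {y} {z} {z′} 2≤n y-inj z-inj exch z′≡x = sameTour-from-< 2≤n z-inj y-inj agree
  where
  agree : ∀ a b → toℕ a < toℕ b → χ z a b ≡ χ y a b
  agree a b a<b with exch a b a<b
  ... | inj₁ (x≡z , y≡z′) = trans (sym x≡z) (trans (sym (z′≡x a b)) (sym y≡z′))
  ... | inj₂ (_ , y≡z)    = sym y≡z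

exchanged-swap : ∀ {n} {x y z z′ : Tour n} → Exchanged x y z z′ → Exchanged y x z z′
exchanged-swap exch a b a<b with exch a b a<b
... | inj₁ (x≡z , y≡z′) = inj₂ (y≡z′ , x≡z)
... | inj₂ (x≡z′ , y≡z) = inj₁ (y≡z , x≡z′)

exchanged⇒¬adjacent : ∀ {n} {x y z z′ : Tour n} → 2 ≤ n →
                      Pyramidal x → Pyramidal y → Pyramidal z → Pyramidal z′ →
                      ¬ SameTour z x → ¬ SameTour z y → Exchanged x y z z′ → ¬ Adjacent x y
exchanged⇒¬adjacent {x = x} {y} {z} {z′} 2≤n px py pz pz′ z≢x z≢y exch (c , cx≡cy , maximal) =
  ℚₚ.<-irrefl (·χ-exchanged exch c) (ℚₚ.+-mono-< cz<cx (subst ((c ·χ z′) ℚ.<_) cx≡cy cz′<cx))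
  where
  cz<cx = maximal z pz z≢x z≢y
  cz′<cx = maximal z′ pz′ (z≢y ∘ exchanged-sameTour 2≤n (proj₁ py) (proj₁ pz) exch)
                          (z≢x ∘ exchanged-sameTour 2≤n (proj₁ px) (proj₁ pz) (exchanged-swap exch))

-- Non-adjacency

EdgesWithin : ∀ {n} → Tour n → Tour n → Tour n → Set
EdgesWithin z x y = ∀ a b → TourEdge z a b → TourEdge x a b ⊎ TourEdge y a b

toFin : ∀ {N} a → a ≤ N → ∃ λ (i : Fin (suc N)) → toℕ i ≡ a
toFin a a≤N = fromℕ< (s≤s a≤N) , Finₚ.toℕ-fromℕ< (s≤s a≤N)

χ-via : ∀ {n} {s t : Tour n} {a b} {P Q : Set} →
        TourEdge s a b ⇔ P → P ⇔ Q → TourEdge t a b ⇔ Q → χ s a b ≡ χ t a b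
χ-via s⇔P P⇔Q t⇔Q = χ-cong (⇔-trans s⇔P (⇔-trans P⇔Q (⇔-sym t⇔Q)))

module Complement {N : ℕ} (2≤N : 2 ≤ N) {x y z : Tour (suc N)}
                  (px : Pyramidal x) (py : Pyramidal y) (pz : Pyramidal z)
                  (z⊆x∪y : EdgesWithin z x y) where

  private
    module X = PyramidalLabelling px
    module Y = PyramidalLabelling py
    module Z = PyramidalLabelling pz

  open Labellings N

  covered : ∀ a b → a < b → b ≤ N → Edge Z.label a b → Edge X.label a b ⊎ Edge Y.label a b
  covered a b a<b b≤N eZ with toFin a (≤-trans (<⇒≤ a<b) b≤N) | toFin b b≤N
  ... | fa , refl | fb , refl =
    Sum.map (X.tourEdge⇒edge a<b) (Y.tourEdge⇒edge a<b) (z⊆x∪y fa fb (Z.edge⇒tourEdge a<b eZ))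

  open Exchange N 2≤N X.label Y.label Z.label covered

  private module W = FromLabelling N Z′

  z′-edge⇔ : ∀ {a b} → a < b → b ≤ N → Edge W.label a b ⇔ Edge Z′ a b
  z′-edge⇔ a<b b≤N = constant⇒edge⇔ 2≤N a<b b≤N λ (_ , _ , 0<v , v<N) (_ , _ , 0<w , w<N) →
    trans (agree 0<v v<N) (sym (agree 0<w w<N))
    where
    agree : ∀ {v} → 0 < v → v < N → (W.label ⊕ Z′) v ≡ false
    agree {v} 0<v v<N = trans (cong (_xor Z′ v) (W.label-tour 0<v v<N)) (xor-same (Z′ v))

  module _ {a b : Fin (suc N)} (a<b : toℕ a < toℕ b) where

    private
      z′⇔Z′ : TourEdge W.tour a b ⇔ Edge Z′ (toℕ a) (toℕ b)
      z′⇔Z′ = ⇔-trans (W.tourEdge⇔edge a<b) (z′-edge⇔ a<b (Finₚ.toℕ≤pred[n] b))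

    χx≡χz : Edge X.label (toℕ a) (toℕ b) ⇔ Edge Z.label (toℕ a) (toℕ b) → χ x a b ≡ χ z a b
    χx≡χz X⇔Z = χ-via (X.tourEdge⇔edge a<b) X⇔Z (Z.tourEdge⇔edge a<b)

    χy≡χz : Edge Y.label (toℕ a) (toℕ b) ⇔ Edge Z.label (toℕ a) (toℕ b) → χ y a b ≡ χ z a b
    χy≡χz Y⇔Z = χ-via (Y.tourEdge⇔edge a<b) Y⇔Z (Z.tourEdge⇔edge a<b)

    χx≡χz′ : Edge X.label (toℕ a) (toℕ b) ⇔ Edge Z′ (toℕ a) (toℕ b) → χ x a b ≡ χ W.tour a b
    χx≡χz′ X⇔Z′ = χ-via (X.tourEdge⇔edge a<b) X⇔Z′ z′⇔Z′

    χy≡χz′ : Edge Y.label (toℕ a) (toℕ b) ⇔ Edge Z′ (toℕ a) (toℕ b) → χ y a b ≡ χ W.tour a b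
    χy≡χz′ Y⇔Z′ = χ-via (Y.tourEdge⇔edge a<b) Y⇔Z′ z′⇔Z′

  exchanged : Exchanged x y z W.tour
  exchanged a b a<b =
    Sum.map (Product.map (χx≡χz a<b) (χy≡χz′ a<b)) (Product.map (χx≡χz′ a<b) (χy≡χz a<b))
            (exchange (toℕ a) (toℕ b) a<b (Finₚ.toℕ≤pred[n] b))

  ¬adjacent : ¬ SameTour z x → ¬ SameTour z y → ¬ Adjacent x y
  ¬adjacent z≢x z≢y =
    exchanged⇒¬adjacent (≤-trans 2≤N (n≤1+n N)) px py pz W.tour-pyramidal z≢x z≢y exchanged

-- Adjacency

anyFunction? : ∀ m {k} {P : (Fin m → Fin k) → Set} → (∀ {f g} → f ≗ g → P f → P g) →
               (∀ f → Dec (P f)) → Dec (∃ P)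
anyFunction? zero    resp P? = map′ (empty ,_) (λ (f , p) → resp (λ ()) p) (P? empty)
  where empty = λ ()
anyFunction? (suc m) resp P? =
  map′ (λ (a , f , p) → a ∷ f , p)
       (λ (f , p) → f Fin.zero , f ∘ Fin.suc , resp (λ { Fin.zero → refl ; (Fin.suc i) → refl }) p)
       (Finₚ.any? λ a → anyFunction? m (λ f≗g → resp λ { Fin.zero → refl ; (Fin.suc i) → f≗g i })
                                       (λ f → P? (a ∷ f)))

pyramidal? : ∀ {n} (t : Tour n) → Dec (Pyramidal t)
pyramidal? {n} t =
  map′ (λ f {i} {j} → f i j) (λ f i j → f {i} {j})
       (Finₚ.all? λ i → Finₚ.all? λ j → (t i Finₚ.≟ t j) →-dec (i Finₚ.≟ j)) ×-dec
  (Finₚ.all? λ i → (toℕ i ℕ.≟ 0) →-dec (toℕ (t i) ℕ.≟ 0)) ×-dec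
  Finₚ.any? λ k → (toℕ (t k) ℕ.≟ n ℕ.∸ 1) ×-dec
    (Finₚ.all? λ i → Finₚ.all? λ j →
       (toℕ i ℕ.<? toℕ j) →-dec (toℕ j ℕ.≤? toℕ k) →-dec (toℕ (t i) ℕ.<? toℕ (t j))) ×-dec
    (Finₚ.all? λ i → Finₚ.all? λ j →
       (toℕ k ℕ.≤? toℕ i) →-dec (toℕ i ℕ.<? toℕ j) →-dec (toℕ (t j) ℕ.<? toℕ (t i)))

sameTour? : ∀ {n} (s t : Tour n) → Dec (SameTour s t)
sameTour? s t = Finₚ.all? λ a → Finₚ.all? λ b → χ s a b ℕ.≟ χ t a b

cost : ∀ {P : Set} → Dec P → ℚ
cost (yes _) = 0ℚ
cost (no _)  = ℚ.- 1ℚ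

indicator : ∀ {Q : Set} → Dec Q → ℕ
indicator e = if does e then 1 else 0

cost-≤0 : ∀ {P Q : Set} (d : Dec P) (e : Dec Q) → cost d ℚ.* ⟦ indicator e ⟧ ℚ.≤ 0ℚ
cost-≤0 (yes _) e      = ℚₚ.≤-reflexive (ℚₚ.*-zeroˡ ⟦ indicator e ⟧)
cost-≤0 (no _) (yes _) = toWitness {a? = ℚ.- 1ℚ ℚ.≤? 0ℚ} _
cost-≤0 (no _) (no _)  = ℚₚ.≤-refl

cost-≡0 : ∀ {P Q : Set} (d : Dec P) (e : Dec Q) → (Q → P) → cost d ℚ.* ⟦ indicator e ⟧ ≡ 0ℚ
cost-≡0 (yes _) e      _   = ℚₚ.*-zeroˡ ⟦ indicator e ⟧
cost-≡0 (no ¬p) (yes q) q⇒p = contradiction (q⇒p q) ¬p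
cost-≡0 (no _) (no _)  _   = refl

cost-<0 : ∀ {P Q : Set} (d : Dec P) (e : Dec Q) → ¬ P → Q → cost d ℚ.* ⟦ indicator e ⟧ ℚ.< 0ℚ
cost-<0 (yes p) _       ¬p _ = contradiction p ¬p
cost-<0 (no _)  (yes _) _  _ = toWitness {a? = ℚ.- 1ℚ ℚ.<? 0ℚ} _
cost-<0 (no _)  (no ¬q) _  q = contradiction q ¬q

module Separation {n} (2≤n : 2 ≤ n) (x y : Tour n) where

  OnXY : Fin n → Fin n → Set
  OnXY a b = TourEdge x a b ⊎ TourEdge y a b

  onXY? : ∀ a b → Dec (OnXY a b)
  onXY? a b = tourEdge? x a b ⊎-dec tourEdge? y a b

  penalty : Fin n → Fin n → ℚ
  penalty a b = cost (onXY? a b)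

  penalty-within : ∀ {t} → EdgesWithin t x y → penalty ·χ t ≡ 0ℚ
  penalty-within {t} t⊆x∪y = sumFin-0 λ a → sumFin-0 λ b →
    when-≡0 (toℕ a ℕ.<? toℕ b) (cost-≡0 (onXY? a b) (tourEdge? t a b) (t⊆x∪y a b))

  penalty-edge<0 : ∀ {t} a b → toℕ a < toℕ b → TourEdge t a b → ¬ OnXY a b → penalty ·χ t ℚ.< 0ℚ
  penalty-edge<0 {t} a b a<b e ¬xy =
    sumFin-<0 (λ a′ → sumFin-≤0 λ b′ → weight≤0 a′ b′) a
      (sumFin-<0 (weight≤0 a) b
        (subst (ℚ._< 0ℚ) (sym (when-yes (toℕ a ℕ.<? toℕ b) a<b)) (cost-<0 (onXY? a b) (tourEdge? t a b) ¬xy e)))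
    where
    weight≤0 : ∀ a b → weight penalty t a b ℚ.≤ 0ℚ
    weight≤0 a b = when-≤0 (toℕ a ℕ.<? toℕ b) (cost-≤0 (onXY? a b) (tourEdge? t a b))

  onXY-sym : ∀ {a b} → OnXY a b → OnXY b a
  onXY-sym (inj₁ ex) = inj₁ (tourEdge-sym {t = x} ex)
  onXY-sym (inj₂ ey) = inj₂ (tourEdge-sym {t = y} ey)

  penalty-outside : ∀ {t} → IsHamiltonian t → (∃₂ λ a b → TourEdge t a b × ¬ OnXY a b) →
                    penalty ·χ t ℚ.< 0ℚ
  penalty-outside {t} t-inj (a , b , e , ¬xy) = by-order (<-cmp (toℕ a) (toℕ b))
    where
    by-order : Tri (toℕ a < toℕ b) (toℕ a ≡ toℕ b) (toℕ b < toℕ a) → penalty ·χ t ℚ.< 0ℚ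
    by-order (tri< a<b _ _) = penalty-edge<0 {t} a b a<b e ¬xy
    by-order (tri≈ _ a≡b _) = contradiction (subst (TourEdge t a) (sym (Finₚ.toℕ-injective a≡b)) e)
                                            (tourEdge-irrefl {t = t} {a} 2≤n t-inj)
    by-order (tri> _ _ b<a) = penalty-edge<0 {t} b a b<a (tourEdge-sym {t = t} e) (¬xy ∘ onXY-sym)

  edge⇒onXY? : ∀ t a b → Dec (TourEdge t a b → OnXY a b)
  edge⇒onXY? t a b = tourEdge? t a b →-dec onXY? a b

  ¬within⇒outside : ∀ {t} → ¬ EdgesWithin t x y → ∃₂ λ a b → TourEdge t a b × ¬ OnXY a b
  ¬within⇒outside {t} ¬within with Finₚ.¬∀⟶∃¬ n _ (λ a → Finₚ.all? (edge⇒onXY? t a)) ¬within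
  ... | a , ¬∀b with Finₚ.¬∀⟶∃¬ n _ (edge⇒onXY? t a) ¬∀b
  ...   | b , ¬[e⇒xy] with tourEdge? t a b
  ...     | yes e = a , b , e , λ xy → ¬[e⇒xy] (λ _ → xy)
  ...     | no ¬e = contradiction (λ e → contradiction e ¬e) ¬[e⇒xy]

  Candidate : Tour n → Set
  Candidate z = Pyramidal z × ¬ SameTour z x × ¬ SameTour z y × EdgesWithin z x y

  candidate? : ∀ z → Dec (Candidate z)
  candidate? z = pyramidal? z ×-dec ¬? (sameTour? z x) ×-dec ¬? (sameTour? z y) ×-dec
                 Finₚ.all? λ a → Finₚ.all? (edge⇒onXY? z a)

  candidate-resp : ∀ {f g} → f ≗ g → Candidate f → Candidate g
  candidate-resp f≗g (pf , f≢x , f≢y , f⊆x∪y) =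
    pyramidal-resp f≗g pf ,
    (λ g≡x → f≢x λ a b → trans (χ-resp f≗g a b) (g≡x a b)) ,
    (λ g≡y → f≢y λ a b → trans (χ-resp f≗g a b) (g≡y a b)) ,
    (λ a b → f⊆x∪y a b ∘ tourEdge-resp (sym ∘ f≗g))

  no-candidate⇒adjacent : ¬ ∃ Candidate → Adjacent x y
  no-candidate⇒adjacent none =
    penalty , trans penalty-x (sym (penalty-within (λ _ _ → inj₂))) , λ z pz z≢x z≢y →
      subst (penalty ·χ z ℚ.<_) (sym penalty-x)
            (penalty-outside (proj₁ pz) (¬within⇒outside λ z⊆x∪y → none (z , pz , z≢x , z≢y , z⊆x∪y)))
    where penalty-x = penalty-within (λ _ _ → inj₁)

  ¬adjacent⇒candidate : ¬ Adjacent x y → ∃ Candidate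
  ¬adjacent⇒candidate ¬adj =
    decidable-stable (anyFunction? n candidate-resp candidate?) (¬adj ∘ no-candidate⇒adjacent)

lemma1 : (n : ℕ) → 3 ≤ n → (x y : Tour n) → Pyramidal x → Pyramidal y →
           ¬ SameTour x y →
           ((¬ Adjacent x y) →
              ∃ λ (z : Tour n) → Pyramidal z × ¬ SameTour z x × ¬ SameTour z y ×
                (∀ a b → TourEdge z a b → TourEdge x a b ⊎ TourEdge y a b))
           ×
           ((∃ λ (z : Tour n) → Pyramidal z × ¬ SameTour z x × ¬ SameTour z y ×
                (∀ a b → TourEdge z a b → TourEdge x a b ⊎ TourEdge y a b))
              → ¬ Adjacent x y)
lemma1 (suc N) (s≤s 2≤N) x y px py _ =
  Separation.¬adjacent⇒candidate (≤-trans 2≤N (n≤1+n N)) x y ,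
  λ (z , pz , z≢x , z≢y , z⊆x∪y) → Complement.¬adjacent 2≤N px py pz z⊆x∪y z≢x z≢y
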